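{- Let $p=2$ and $n\ge1$. For $y_0,y_1\in\mathbb{F}_2$ and $x_{i,0},x_{i,1}\in\mathbb{F}_2$ ($0\le i\le n-1$), set $y=2y_1+y_0\in\{0,1,2,3\}$ and $x_i=2x_{i,1}+x_{i,0}\in\{0,1,2,3\}$ (as integers, with $\mathbb{F}_2=\{0,1\}$). Let $\operatorname{ismax}(y;x_0,\dots,x_{n-1})\in\mathbb{F}_2$ be $1$ if $\max(x_0,\dots,x_{n-1})=y$ and $0$ otherwise. Then a minimal polynomial expression, in the variables $y_0,y_1,x_{i,0},x_{i,1}$ over $\mathbb{F}_2$, is \[ \operatorname{ismax}(y;x_0,\dots,x_{n-1})=y_1y_0+y_1\prod_{i=0}^{n-1}(1+x_{i,1}x_{i,0})+(y_1+y_0)\prod_{i=0}^{n-1}(1+x_{i,1})+(y_1+1)\prod_{i=0}^{n-1}(1+x_{i,1})(1+x_{i,0}). \]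
   Context: A minimal polynomial expression is a polynomial over $\mathbb{F}_2$ of degree at most $1$ in each of the variables $y_0,y_1,x_{i,0},x_{i,1}$ that coincides with the given function for all values of these variables in $\mathbb{F}_2$. -}

module Defs where

open import Data.Bool using (Bool; true; false; _∧_; _xor_)
open import Data.Nat using (ℕ; zero; suc; _+_; _*_; _⊔_; _≟_)
open import Data.Fin using (Fin; zero; suc)
open import Relation.Nullary.Decidable using (isYes)

-- 𝔽₂ is modelled as Bool: addition = _xor_, multiplication = _∧_,
-- 0 = false, 1 = true.
𝔽₂ : Set
𝔽₂ = Bool

val : 𝔽₂ → ℕ
val false = 0
val true  = 1

digit2 : 𝔽₂ → 𝔽₂ → ℕ
digit2 b₁ b₀ = 2 * val b₁ + val b₀

-- maximum of finitely many naturals (max of the empty family is 0;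
-- only used with n ≥ 1)
maxF : (n : ℕ) → (Fin n → ℕ) → ℕ
maxF zero    f = 0
maxF (suc n) f = f zero ⊔ maxF n (λ i → f (suc i))

prodF : (n : ℕ) → (Fin n → 𝔽₂) → 𝔽₂
prodF zero    f = true
prodF (suc n) f = f zero ∧ prodF n (λ i → f (suc i))

ismax : (n : ℕ) → 𝔽₂ → 𝔽₂ → (Fin n → 𝔽₂) → (Fin n → 𝔽₂) → 𝔽₂
ismax n y₀ y₁ x₀ x₁ = isYes (maxF n (λ i → digit2 (x₁ i) (x₀ i)) ≟ digit2 y₁ y₀)

-- Each of the three products is the indicator of an upper bound on m = max xᵢ:
-- ∏ (1 + x_{i,1} x_{i,0}) says no xᵢ is 3, i.e. m ≤ 2; ∏ (1 + x_{i,1}) says m ≤ 1;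
-- ∏ (1 + x_{i,1})(1 + x_{i,0}) says m = 0. Since m ≤ 3, the identity becomes a
-- truth table in m, y₀, y₁.
module Submission where

open import Defs
open import Data.Bool using (true; false; _∧_; _xor_)
open import Data.Nat using (ℕ; zero; suc; _≤_; _⊔_; _≟_; _≤?_; z≤n; s≤s)
open import Data.Nat.Properties using (⊔-lub; m⊔n≤o⇒m≤o; m⊔n≤o⇒n≤o)
open import Data.Fin using (Fin; zero; suc)
open import Function using (_∘_)
open import Relation.Nullary.Decidable using (yes; no; isYes; isYes≗does; dec-true; dec-false)
open import Relation.Binary.PropositionalEquality using (_≡_; refl; sym; trans; cong; cong₂)

prodF-cong : ∀ n {f g : Fin n → 𝔽₂} → (∀ i → f i ≡ g i) → prodF n f ≡ prodF n g
prodF-cong zero    f≡g = refl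
prodF-cong (suc n) f≡g = cong₂ _∧_ (f≡g zero) (prodF-cong n (λ i → f≡g (suc i)))

maxF-lub : ∀ n (f : Fin n → ℕ) {k} → (∀ i → f i ≤ k) → maxF n f ≤ k
maxF-lub zero    f f≤k = z≤n
maxF-lub (suc n) f f≤k = ⊔-lub (f≤k zero) (maxF-lub n (λ i → f (suc i)) (λ i → f≤k (suc i)))

isYes-⊔-≤? : ∀ a b k → isYes (a ⊔ b ≤? k) ≡ isYes (a ≤? k) ∧ isYes (b ≤? k)
isYes-⊔-≤? a b k with a ≤? k | b ≤? k
... | yes a≤k | yes b≤k = trans (isYes≗does (a ⊔ b ≤? k)) (dec-true  (a ⊔ b ≤? k) (⊔-lub a≤k b≤k))
... | yes _   | no  b≰k = trans (isYes≗does (a ⊔ b ≤? k)) (dec-false (a ⊔ b ≤? k) (b≰k ∘ m⊔n≤o⇒n≤o a b))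
... | no  a≰k | _       = trans (isYes≗does (a ⊔ b ≤? k)) (dec-false (a ⊔ b ≤? k) (a≰k ∘ m⊔n≤o⇒m≤o a b))

prodF-isYes-≤?-maxF : ∀ n (f : Fin n → ℕ) k →
  prodF n (λ i → isYes (f i ≤? k)) ≡ isYes (maxF n f ≤? k)
prodF-isYes-≤?-maxF zero    f k = refl
prodF-isYes-≤?-maxF (suc n) f k = trans
  (cong (isYes (f zero ≤? k) ∧_) (prodF-isYes-≤?-maxF n (λ i → f (suc i)) k))
  (sym (isYes-⊔-≤? (f zero) (maxF n (λ i → f (suc i))) k))

digit2≤3 : ∀ b₁ b₀ → digit2 b₁ b₀ ≤ 3
digit2≤3 false false = z≤n
digit2≤3 false true  = s≤s z≤n
digit2≤3 true  false = s≤s (s≤s z≤n)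
digit2≤3 true  true  = s≤s (s≤s (s≤s z≤n))

digit2≤?2 : ∀ b₁ b₀ → true xor (b₁ ∧ b₀) ≡ isYes (digit2 b₁ b₀ ≤? 2)
digit2≤?2 false false = refl
digit2≤?2 false true  = refl
digit2≤?2 true  false = refl
digit2≤?2 true  true  = refl

digit2≤?1 : ∀ b₁ b₀ → true xor b₁ ≡ isYes (digit2 b₁ b₀ ≤? 1)
digit2≤?1 false false = refl
digit2≤?1 false true  = refl
digit2≤?1 true  false = refl
digit2≤?1 true  true  = refl

digit2≤?0 : ∀ b₁ b₀ → (true xor b₁) ∧ (true xor b₀) ≡ isYes (digit2 b₁ b₀ ≤? 0)
digit2≤?0 false false = refl
digit2≤?0 false true  = refl
digit2≤?0 true  false = refl
digit2≤?0 true  true  = refl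

prodF-digit2≤? : ∀ n (x₀ x₁ : Fin n → 𝔽₂) {t : 𝔽₂ → 𝔽₂ → 𝔽₂} k →
  (∀ b₁ b₀ → t b₁ b₀ ≡ isYes (digit2 b₁ b₀ ≤? k)) →
  prodF n (λ i → t (x₁ i) (x₀ i)) ≡ isYes (maxF n (λ i → digit2 (x₁ i) (x₀ i)) ≤? k)
prodF-digit2≤? n x₀ x₁ k t≡ =
  trans (prodF-cong n (λ i → t≡ (x₁ i) (x₀ i))) (prodF-isYes-≤?-maxF n (λ i → digit2 (x₁ i) (x₀ i)) k)

isYes-≟-digit2 : ∀ {m} → m ≤ 3 → ∀ y₀ y₁ →
  isYes (m ≟ digit2 y₁ y₀) ≡
    (y₁ ∧ y₀)
    xor (y₁ ∧ isYes (m ≤? 2))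
    xor ((y₁ xor y₀) ∧ isYes (m ≤? 1))
    xor ((y₁ xor true) ∧ isYes (m ≤? 0))
isYes-≟-digit2 z≤n                   false false = refl
isYes-≟-digit2 z≤n                   false true  = refl
isYes-≟-digit2 z≤n                   true  false = refl
isYes-≟-digit2 z≤n                   true  true  = refl
isYes-≟-digit2 (s≤s z≤n)             false false = refl
isYes-≟-digit2 (s≤s z≤n)             false true  = refl
isYes-≟-digit2 (s≤s z≤n)             true  false = refl
isYes-≟-digit2 (s≤s z≤n)             true  true  = refl
isYes-≟-digit2 (s≤s (s≤s z≤n))       false false = refl
isYes-≟-digit2 (s≤s (s≤s z≤n))       false true  = refl
isYes-≟-digit2 (s≤s (s≤s z≤n))       true  false = refl
isYes-≟-digit2 (s≤s (s≤s z≤n))       true  true  = refl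
isYes-≟-digit2 (s≤s (s≤s (s≤s z≤n))) false false = refl
isYes-≟-digit2 (s≤s (s≤s (s≤s z≤n))) false true  = refl
isYes-≟-digit2 (s≤s (s≤s (s≤s z≤n))) true  false = refl
isYes-≟-digit2 (s≤s (s≤s (s≤s z≤n))) true  true  = refl

proposition7p1 : (n : ℕ) → 1 ≤ n → (y₀ y₁ : 𝔽₂) → (x₀ x₁ : Fin n → 𝔽₂) →
    ismax n y₀ y₁ x₀ x₁ ≡
      (y₁ ∧ y₀)
      xor (y₁ ∧ prodF n (λ i → true xor (x₁ i ∧ x₀ i)))
      xor ((y₁ xor y₀) ∧ prodF n (λ i → true xor x₁ i))
      xor ((y₁ xor true) ∧ prodF n (λ i → (true xor x₁ i) ∧ (true xor x₀ i)))
proposition7p1 n _ y₀ y₁ x₀ x₁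
  rewrite prodF-digit2≤? n x₀ x₁ 2 digit2≤?2
        | prodF-digit2≤? n x₀ x₁ 1 digit2≤?1
        | prodF-digit2≤? n x₀ x₁ 0 digit2≤?0
  = isYes-≟-digit2 (maxF-lub n _ (λ i → digit2≤3 (x₁ i) (x₀ i))) y₀ y₁
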